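{- Let $t$ be a positive integer and $G_t$, $T_t$ as constructed below. For every integer $n\ge 8$ and every $n$-vertex induced subgraph $G$ of the total graph $\mathcal T(G_t)$, there is a node $u$ of $T_t$ such that the number of descendants of $u$ (in $T_t$) lying in $V(G)$ is at least $\frac{n}{8\cdot 3^{t+1}}$ and at most $\frac n4$, and every node $v$ of $T_t$ in the same layer as $u$ has at most $\frac n4$ descendants in $V(G)$.
   Context: Every node is its own descendant. A trigraph is a triple $(V,E_B,E_R)$ with disjoint black and red edge sets; its total graph $\mathcal T(\cdot)$ is $(V,E_B\cup E_R)$. Construction of $G_t$ and rooted tree $T_t$ (same vertex set): layers $L_0, L_1,\dots$, each a finite path of black edges ordered left to right; $L_0$ is a single vertex, the root of $T_t$. Given $L_{\le i}=L_0\cup\dots\cup L_i$, build $L_{i+1}$: for each $u\in L_i$ from left to right, let $N^\uparrow[u] := (N_{\mathcal T(G_t)}(u)\cap L_{\le i-1})\cup\{u\}$; for every ordered pair $(B,R)$ of disjoint subsets of $N^\uparrow[u]$ with $|B\cup R|\le t$, append a new vertex $v_{B,R}$ at the right end of $L_{i+1}$, joined by a black edge to the previous rightmost vertex of $L_{i+1}$ (if any), make it a child of $u$ in $T_t$, and add black edges from $v_{B,R}$ to all of $B$ and red edges to all of $R$. The layer of a node is the $L_i$ containing it. -}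

module Defs where

open import Data.Nat using (ℕ; zero; suc; _+_; _∸_; _≤_; _<_; _≤?_)
open import Data.Nat.Properties using (_≟_)
open import Data.Product using (_×_; _,_; proj₁; proj₂)
open import Data.Product.Properties using (≡-dec)
open import Data.List using (List; []; _∷_; _++_; map; concatMap; filter; length)
open import Data.Maybe using (Maybe; just; nothing)
open import Relation.Binary.PropositionalEquality using (_≡_)
open import Relation.Nullary using (Dec)
open import Relation.Nullary.Decidable using (_×-dec_)

-- A node of G_t / T_t is identified by (i , j): the j-th vertex (from the
-- left, counting from 0) of layer L_i.
Vtx : Set
Vtx = ℕ × ℕ

-- Data recorded for each vertex when it is created: the position of its
-- parent u in the previous layer, and the sets B (black up-edges) and R
-- (red up-edges) chosen for it.
record Info : Set where
  constructor mkInfo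
  field
    parent : ℕ
    black  : List Vtx
    red    : List Vtx
open Info public

-- A choice for each element of N↑[u]: not chosen, put in B, put in R.
-- Ordered pairs (B,R) of disjoint subsets of N↑[u] correspond exactly to
-- such labellings.
data Col : Set where
  none blk rd : Col

labellings : ℕ → List (List Col)
labellings zero    = [] ∷ []
labellings (suc k) =
  concatMap (λ c → map (c ∷_) (labellings k)) (none ∷ blk ∷ rd ∷ [])

chosen : List Col → ℕ
chosen []           = 0
chosen (none ∷ cs)  = chosen cs
chosen (blk ∷ cs)   = suc (chosen cs)
chosen (rd ∷ cs)    = suc (chosen cs)

selBlack : List Vtx → List Col → List Vtx
selBlack (x ∷ xs) (blk ∷ cs) = x ∷ selBlack xs cs
selBlack (x ∷ xs) (_ ∷ cs)   = selBlack xs cs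
selBlack _ _                 = []

selRed : List Vtx → List Col → List Vtx
selRed (x ∷ xs) (rd ∷ cs) = x ∷ selRed xs cs
selRed (x ∷ xs) (_ ∷ cs)  = selRed xs cs
selRed _ _                = []

-- The neighbours
-- of u in T(G_t) lying in L_{≤ i-1} are exactly B ∪ R of u (the only edges
-- between distinct layers are the edges from a new vertex v_{B,R} to B ∪ R;
-- the black path edges stay inside a layer).
Nup : ℕ → ℕ → Info → List Vtx
Nup i j I = black I ++ red I ++ ((i , j) ∷ [])

children : ℕ → ℕ → ℕ → Info → List Info
children t i j I =
  map (λ cs → mkInfo j (selBlack N cs) (selRed N cs))
      (filter (λ cs → chosen cs ≤? t) (labellings (length N)))
  where N = Nup i j I

nextLayer : ℕ → ℕ → ℕ → List Info → List Info
nextLayer t i j []       = []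
nextLayer t i j (I ∷ Is) = children t i j I ++ nextLayer t i (suc j) Is

layer : ℕ → ℕ → List Info
layer t zero    = mkInfo 0 [] [] ∷ []
layer t (suc i) = nextLayer t i 0 (layer t i)

nth : {A : Set} → List A → ℕ → Maybe A
nth []       _       = nothing
nth (x ∷ xs) zero    = just x
nth (x ∷ xs) (suc k) = nth xs k

IsVertex : ℕ → Vtx → Set
IsVertex t (i , j) = j < length (layer t i)

-- parent in T_t (the root is sent to itself; only used on non-root nodes)
parentOf : ℕ → Vtx → Vtx
parentOf t (zero , j)  = (zero , j)
parentOf t (suc i , j) with nth (layer t (suc i)) j
... | just I  = (i , parent I)
... | nothing = (i , 0)

up : ℕ → ℕ → Vtx → Vtx
up t zero    v = v
up t (suc k) v = up t k (parentOf t v)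

-- v is a descendant of u in T_t (every node is its own descendant):
-- u is the ancestor of v in the layer of u.
IsDesc : ℕ → Vtx → Vtx → Set
IsDesc t u v = (proj₁ u ≤ proj₁ v) × (up t (proj₁ v ∸ proj₁ u) v ≡ u)

isDesc? : (t : ℕ) (u v : Vtx) → Dec (IsDesc t u v)
isDesc? t u v = (proj₁ u ≤? proj₁ v) ×-dec ≡-dec _≟_ _≟_ (up t (proj₁ v ∸ proj₁ u) v) u

#desc : ℕ → List Vtx → Vtx → ℕ
#desc t S u = length (filter (isDesc? t u) S)

{-# OPTIONS --safe #-}
module Submission where

-- Call a node u heavy when 4 d(u) > n, where d(u) counts the descendants of u in V(G).
-- The root is heavy (d = n) and no node below the deepest vertex of G is, so some layer
-- L_k contains a heavy node p while L_{k+1} contains none.  Every descendant of p other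
-- than p itself descends from a child of p, so d(p) ≤ 1 + Σ d(c) over the children c of p,
-- and p has at most 3^{t+1} children because |N↑[p]| ≤ t + 1.  If all children had
-- 8·3^{t+1}·d(c) < n, then 8 Σ d(c) ≤ n and 4 d(p) ≤ 4 + n/2 ≤ n as n ≥ 8, so p would not
-- be heavy.  Hence some child of p is the required node.

open import Defs
open import Data.Nat
  using (ℕ; zero; suc; pred; _+_; _*_; _^_; _∸_; _≤_; _<_; z≤n; s≤s; z<s)
open import Data.Nat.Properties
open import Data.Nat.ListAction using (sum)
open import Algebra.Properties.CommutativeSemigroup +-commutativeSemigroup using (interchange)
open import Data.Product using (_×_; _,_; proj₁; proj₂; ∃-syntax)
open import Data.Product.Properties using (≡-dec)
open import Data.Sum using (_⊎_; inj₁; inj₂)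
open import Data.Maybe using (just; nothing)
open import Data.List using (List; []; _∷_; _++_; [_]; length; map; filter; concatMap)
open import Data.List.Properties
  using (length-++; length-map; length-filter; filter-++; filter-all; filter-none; filter-accept; map-cong)
open import Data.List.Membership.Propositional using (_∈_; find)
open import Data.List.Membership.Propositional.Properties using (∈-map⁺; ∈-map⁻)
open import Data.List.Relation.Unary.All using (All; []; _∷_)
import Data.List.Relation.Unary.All as All
import Data.List.Relation.Unary.All.Properties as All
open import Data.List.Relation.Unary.Any using (here; there; any?)
open import Data.List.Relation.Unary.Unique.Propositional using (Unique)
open import Data.List.Relation.Unary.AllPairs using ([]; _∷_)
open import Relation.Binary.Definitions using (DecidableEquality)
open import Relation.Binary.PropositionalEquality
  using (_≡_; _≢_; refl; sym; trans; cong; cong₂; subst)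
open import Relation.Nullary using (¬_; yes; no; contradiction)
open import Relation.Unary using (Decidable)
open import Function using (_∘′_)

count : {A : Set} {P : A → Set} → Decidable P → List A → ℕ
count P? xs = length (filter P? xs)

module _ {A : Set} {P : A → Set} (P? : Decidable P) where

  count-++ : ∀ xs ys → count P? (xs ++ ys) ≡ count P? xs + count P? ys
  count-++ xs ys = trans (cong length (filter-++ P? xs ys)) (length-++ (filter P? xs))

  count-[x] : ∀ {x} → P x → count P? [ x ] ≡ 1
  count-[x] Px = cong length (filter-accept P? Px)

  count-none : ∀ {xs} → All (λ x → ¬ P x) xs → count P? xs ≡ 0
  count-none ¬Ps = cong length (filter-none P? ¬Ps)

count-≡-≤1 : {A : Set} (_≟_ : DecidableEquality A) (y : A) {xs : List A} →
             Unique xs → count (_≟ y) xs ≤ 1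
count-≡-≤1 _≟_ y {[]} [] = z≤n
count-≡-≤1 _≟_ y {x ∷ xs} (x∉xs ∷ unique) with x ≟ y
... | yes refl =
  s≤s (≤-reflexive (count-none (_≟ y) (All.map (λ x≢z z≡x → x≢z (sym z≡x)) x∉xs)))
... | no _ = count-≡-≤1 _≟_ y unique

module _ {A : Set} (f : A → ℕ) where

  ∈⇒≤sum-map : ∀ {x xs} → x ∈ xs → f x ≤ sum (map f xs)
  ∈⇒≤sum-map {xs = x ∷ xs} (here refl) = m≤m+n (f x) _
  ∈⇒≤sum-map {xs = y ∷ xs} (there x∈xs) = ≤-trans (∈⇒≤sum-map x∈xs) (m≤n+m _ (f y))

  sum-map-≤ : ∀ {n xs} → All (λ x → f x ≤ n) xs → sum (map f xs) ≤ length xs * n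
  sum-map-≤ [] = z≤n
  sum-map-≤ (fx≤n ∷ fxs≤n) = +-mono-≤ fx≤n (sum-map-≤ fxs≤n)

  sum-map-+ : (g : A → ℕ) (xs : List A) →
              sum (map (λ x → f x + g x) xs) ≡ sum (map f xs) + sum (map g xs)
  sum-map-+ g [] = refl
  sum-map-+ g (x ∷ xs) = trans (cong (f x + g x +_) (sum-map-+ g xs)) (interchange (f x) (g x) _ _)

  *-distribˡ-sum-map : ∀ c xs → c * sum (map f xs) ≡ sum (map (λ x → c * f x) xs)
  *-distribˡ-sum-map c [] = *-zeroʳ c
  *-distribˡ-sum-map c (x ∷ xs) =
    trans (*-distribˡ-+ c (f x) _) (cong (c * f x +_) (*-distribˡ-sum-map c xs))

module _ {A : Set} {P Q : A → Set} {R : ℕ → A → Set}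
         (P? : Decidable P) (Q? : Decidable Q) (R? : ∀ j → Decidable (R j)) (js : List ℕ) where

  Covers : A → Set
  Covers x = P x → Q x ⊎ ∃[ j ] (j ∈ js × R j x)

  countR : List A → ℕ
  countR xs = sum (map (λ j → count (R? j) xs) js)

  count-union-bound-[x] : ∀ {x} → Covers x → count P? [ x ] ≤ count Q? [ x ] + countR [ x ]
  count-union-bound-[x] {x} covers with P? x
  ... | no _ = z≤n
  ... | yes Px with covers Px
  ...   | inj₁ Qx = ≤-trans (≤-reflexive (sym (count-[x] Q? Qx))) (m≤m+n _ _)
  ...   | inj₂ (j , j∈js , Rjx) =
          ≤-trans (≤-reflexive (sym (count-[x] (R? j) Rjx)))
                  (≤-trans (∈⇒≤sum-map (λ j → count (R? j) [ x ]) j∈js) (m≤n+m _ _))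

  count-union-bound : ∀ {xs} → All Covers xs → count P? xs ≤ count Q? xs + countR xs
  count-union-bound {[]} [] = z≤n
  count-union-bound {x ∷ xs} (covers ∷ coverss) = begin
    count P? (x ∷ xs)
      ≡⟨ count-++ P? [ x ] xs ⟩
    count P? [ x ] + count P? xs
      ≤⟨ +-mono-≤ (count-union-bound-[x] covers) (count-union-bound coverss) ⟩
    (count Q? [ x ] + countR [ x ]) + (count Q? xs + countR xs)
      ≡⟨ interchange (count Q? [ x ]) _ _ _ ⟩
    (count Q? [ x ] + count Q? xs) + (countR [ x ] + countR xs)
      ≡⟨ cong₂ _+_ (count-++ Q? [ x ] xs) countR-∷ ⟨
    count Q? (x ∷ xs) + countR (x ∷ xs)
      ∎
    where
      open ≤-Reasoning
      countR-∷ : countR (x ∷ xs) ≡ countR [ x ] + countR xs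
      countR-∷ = trans (cong sum (map-cong (λ j → count-++ (R? j) [ x ] xs) js))
                       (sum-map-+ (λ j → count (R? j) [ x ]) (λ j → count (R? j) xs) js)

switch-point : {Q : ℕ → Set} → Decidable Q → Q 0 →
               ∀ M → ¬ Q M → ∃[ k ] (Q k × ¬ Q (suc k))
switch-point Q? Q0 zero ¬Q0 = contradiction Q0 ¬Q0
switch-point Q? Q0 (suc M) ¬QM+1 with Q? M
... | yes QM = M , QM , ¬QM+1
... | no ¬QM = switch-point Q? Q0 M ¬QM

d≤1+s∧8s≤n⇒4d≤n : ∀ {n d s} → 8 ≤ n → d ≤ 1 + s → 8 * s ≤ n → 4 * d ≤ n
d≤1+s∧8s≤n⇒4d≤n {n} {d} {s} 8≤n d≤1+s 8s≤n = *-cancelˡ-≤ 2 (begin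
  2 * (4 * d)  ≡⟨ *-assoc 2 4 d ⟨
  8 * d        ≤⟨ *-monoʳ-≤ 8 d≤1+s ⟩
  8 * (1 + s)  ≡⟨ *-distribˡ-+ 8 1 s ⟩
  8 + 8 * s    ≤⟨ +-mono-≤ 8≤n 8s≤n ⟩
  n + n        ≡⟨ cong (n +_) (+-identityʳ n) ⟨
  2 * n        ∎)
  where open ≤-Reasoning

positions : {A : Set} {P : A → Set} → Decidable P → List A → List ℕ
positions P? [] = []
positions P? (x ∷ xs) with P? x
... | yes _ = 0 ∷ map suc (positions P? xs)
... | no _  = map suc (positions P? xs)

module _ {A : Set} {P : A → Set} (P? : Decidable P) where

  positions-< : ∀ xs {j} → j ∈ positions P? xs → j < length xs
  positions-< (x ∷ xs) j∈ with P? x | j∈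
  ... | yes _ | here refl = z<s
  ... | yes _ | there j∈′ with ∈-map⁻ suc j∈′
  ...   | i , i∈ , refl = s≤s (positions-< xs i∈)
  positions-< (x ∷ xs) j∈ | no _ | j∈′ with ∈-map⁻ suc j∈′
  ...   | i , i∈ , refl = s≤s (positions-< xs i∈)

  ∈-positions : ∀ xs j {a} → nth xs j ≡ just a → P a → j ∈ positions P? xs
  ∈-positions (x ∷ xs) zero refl Px with P? x
  ... | yes _ = here refl
  ... | no ¬Px = contradiction Px ¬Px
  ∈-positions (x ∷ xs) (suc j) nth≡ Pa with P? x
  ... | yes _ = there (∈-map⁺ suc (∈-positions xs j nth≡ Pa))
  ... | no _  = ∈-map⁺ suc (∈-positions xs j nth≡ Pa)

  length-positions : ∀ xs → length (positions P? xs) ≡ count P? xs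
  length-positions [] = refl
  length-positions (x ∷ xs) with P? x
  ... | yes _ = cong suc (trans (length-map suc (positions P? xs)) (length-positions xs))
  ... | no _  = trans (length-map suc (positions P? xs)) (length-positions xs)

nth≡nothing⇒length≤ : {A : Set} (xs : List A) (j : ℕ) →
                      nth xs j ≡ nothing → length xs ≤ j
nth≡nothing⇒length≤ [] j _ = z≤n
nth≡nothing⇒length≤ (x ∷ xs) (suc j) nth≡ = s≤s (nth≡nothing⇒length≤ xs j nth≡)

All-nth : {A : Set} {P : A → Set} {xs : List A} →
          All P xs → ∀ j {a} → nth xs j ≡ just a → P a
All-nth (Px ∷ _) zero refl = Px
All-nth (_ ∷ Pxs) (suc j) nth≡ = All-nth Pxs j nth≡

length-concatMap-map-∷ : {A : Set} (cs : List A) (L : List (List A)) →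
                         length (concatMap (λ c → map (c ∷_) L) cs) ≡ length cs * length L
length-concatMap-map-∷ [] L = refl
length-concatMap-map-∷ (c ∷ cs) L =
  trans (length-++ (map (c ∷_) L))
        (cong₂ _+_ (length-map (c ∷_) L) (length-concatMap-map-∷ cs L))

length-labellings : ∀ k → length (labellings k) ≡ 3 ^ k
length-labellings zero = refl
length-labellings (suc k) =
  trans (length-concatMap-map-∷ (none ∷ blk ∷ rd ∷ []) (labellings k))
        (cong (3 *_) (length-labellings k))

upDegree : Info → ℕ
upDegree I = length (black I) + length (red I)

length-select≤chosen : ∀ (N : List Vtx) cs →
                       length (selBlack N cs) + length (selRed N cs) ≤ chosen cs
length-select≤chosen [] cs = z≤n
length-select≤chosen (x ∷ xs) [] = z≤n
length-select≤chosen (x ∷ xs) (none ∷ cs) = length-select≤chosen xs cs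
length-select≤chosen (x ∷ xs) (blk ∷ cs) = s≤s (length-select≤chosen xs cs)
length-select≤chosen (x ∷ xs) (rd ∷ cs) =
  ≤-trans (≤-reflexive (+-suc _ _)) (s≤s (length-select≤chosen xs cs))

length-Nup : ∀ i j I → length (Nup i j I) ≡ upDegree I + 1
length-Nup i j I =
  trans (length-++ (black I))
        (trans (cong (length (black I) +_) (length-++ (red I)))
               (sym (+-assoc (length (black I)) (length (red I)) 1)))

deepLayer : List Vtx → ℕ
deepLayer S = sum (map (suc ∘′ proj₁) S)

_≟ᵥ_ : DecidableEquality Vtx
_≟ᵥ_ = ≡-dec _≟_ _≟_

module _ (t : ℕ) where

  children-upDegree : ∀ i j I → All (λ I′ → upDegree I′ ≤ t) (children t i j I)
  children-upDegree i j I =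
    All.map⁺ (All.map (λ {cs} chosen≤t → ≤-trans (length-select≤chosen (Nup i j I) cs) chosen≤t)
                      (All.all-filter (λ cs → chosen cs ≤? t) (labellings (length (Nup i j I)))))

  length-children : ∀ i j I → upDegree I ≤ t → length (children t i j I) ≤ 3 ^ (t + 1)
  length-children i j I deg≤t = begin
    length (children t i j I)     ≡⟨ length-map _ (filter fits? L) ⟩
    length (filter fits? L)       ≤⟨ length-filter fits? L ⟩
    length L                      ≡⟨ length-labellings (length (Nup i j I)) ⟩
    3 ^ length (Nup i j I)        ≤⟨ ^-monoʳ-≤ 3 |Nup|≤t+1 ⟩
    3 ^ (t + 1)                   ∎
    where
      open ≤-Reasoning
      fits? = λ cs → chosen cs ≤? t
      L = labellings (length (Nup i j I))
      |Nup|≤t+1 : length (Nup i j I) ≤ t + 1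
      |Nup|≤t+1 = ≤-trans (≤-reflexive (length-Nup i j I)) (+-monoˡ-≤ 1 deg≤t)

  children-parent : ∀ i j I → All (λ I′ → parent I′ ≡ j) (children t i j I)
  children-parent i j I = All.map⁺ (All.universal (λ _ → refl) _)

  nextLayer-upDegree : ∀ i j Is → All (λ I → upDegree I ≤ t) (nextLayer t i j Is)
  nextLayer-upDegree i j [] = []
  nextLayer-upDegree i j (I ∷ Is) =
    All.++⁺ (children-upDegree i j I) (nextLayer-upDegree i (suc j) Is)

  layer-upDegree : ∀ i → All (λ I → upDegree I ≤ t) (layer t i)
  layer-upDegree zero = z≤n ∷ []
  layer-upDegree (suc i) = nextLayer-upDegree i 0 (layer t i)

  nextLayer-parent≥ : ∀ i j Is → All (λ I → j ≤ parent I) (nextLayer t i j Is)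
  nextLayer-parent≥ i j [] = []
  nextLayer-parent≥ i j (I ∷ Is) =
    All.++⁺ (All.map (λ parent≡j → ≤-reflexive (sym parent≡j)) (children-parent i j I))
            (All.map (≤-trans (n≤1+n j)) (nextLayer-parent≥ i (suc j) Is))

  nextLayer-parent< : ∀ i j Is → All (λ I → parent I < j + length Is) (nextLayer t i j Is)
  nextLayer-parent< i j [] = []
  nextLayer-parent< i j (I ∷ Is) =
    All.++⁺ (All.map (λ parent≡j → subst (_< j + suc (length Is)) (sym parent≡j) (m<m+n j z<s))
                     (children-parent i j I))
            (All.map (λ parent< → ≤-trans parent< (≤-reflexive (sym (+-suc j (length Is)))))
                     (nextLayer-parent< i (suc j) Is))

  parentIs? : (p : ℕ) → Decidable (λ I → parent I ≡ p)
  parentIs? p I = parent I ≟ p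

  childIndices : ℕ → ℕ → List ℕ
  childIndices k p = positions (parentIs? p) (layer t (suc k))

  count-parent-nextLayer : ∀ p i j Is → All (λ I → upDegree I ≤ t) Is →
                           count (parentIs? p) (nextLayer t i j Is) ≤ 3 ^ (t + 1)
  count-parent-nextLayer p i j [] [] = z≤n
  count-parent-nextLayer p i j (I ∷ Is) (deg≤t ∷ degs≤t) with j ≟ p
  ... | yes refl = begin
    count (parentIs? j) (cs ++ rest)                  ≡⟨ count-++ (parentIs? j) cs rest ⟩
    count (parentIs? j) cs + count (parentIs? j) rest ≡⟨ cong (count (parentIs? j) cs +_) rest-none ⟩
    count (parentIs? j) cs + 0                        ≡⟨ +-identityʳ _ ⟩
    count (parentIs? j) cs                            ≤⟨ length-filter (parentIs? j) cs ⟩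
    length cs                                         ≤⟨ length-children i j I deg≤t ⟩
    3 ^ (t + 1)                                       ∎
    where
      open ≤-Reasoning
      cs = children t i j I
      rest = nextLayer t i (suc j) Is
      rest-none : count (parentIs? j) rest ≡ 0
      rest-none = count-none (parentIs? j)
        (All.map (λ j<parent parent≡j → <-irrefl (sym parent≡j) j<parent)
                 (nextLayer-parent≥ i (suc j) Is))
  ... | no j≢p = begin
    count (parentIs? p) (cs ++ rest)                  ≡⟨ count-++ (parentIs? p) cs rest ⟩
    count (parentIs? p) cs + count (parentIs? p) rest ≡⟨ cong (_+ count (parentIs? p) rest) cs-none ⟩
    count (parentIs? p) rest                          ≤⟨ count-parent-nextLayer p i (suc j) Is degs≤t ⟩
    3 ^ (t + 1)                                       ∎
    where
      open ≤-Reasoning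
      cs = children t i j I
      rest = nextLayer t i (suc j) Is
      cs-none : count (parentIs? p) cs ≡ 0
      cs-none = count-none (parentIs? p)
        (All.map (λ parent≡j parent≡p → j≢p (trans (sym parent≡j) parent≡p))
                 (children-parent i j I))

  length-childIndices : ∀ k p → length (childIndices k p) ≤ 3 ^ (t + 1)
  length-childIndices k p =
    ≤-trans (≤-reflexive (length-positions (parentIs? p) (layer t (suc k))))
            (count-parent-nextLayer p k 0 (layer t k) (layer-upDegree k))

  parentOf-isVertex : ∀ v → IsVertex t v → IsVertex t (parentOf t v)
  parentOf-isVertex (zero , j) j< = j<
  parentOf-isVertex (suc i , j) j< with nth (layer t (suc i)) j in nth≡
  ... | just I  = All-nth (nextLayer-parent< i 0 (layer t i)) j nth≡
  ... | nothing = contradiction (nth≡nothing⇒length≤ (layer t (suc i)) j nth≡) (<⇒≱ j<)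

  layer-parentOf : ∀ v → proj₁ (parentOf t v) ≡ proj₁ v ∸ 1
  layer-parentOf (zero , j) = refl
  layer-parentOf (suc i , j) with nth (layer t (suc i)) j
  ... | just I  = refl
  ... | nothing = refl

  up-isVertex : ∀ e v → IsVertex t v → IsVertex t (up t e v)
  up-isVertex zero v v-vtx = v-vtx
  up-isVertex (suc e) v v-vtx = up-isVertex e (parentOf t v) (parentOf-isVertex v v-vtx)

  layer-up : ∀ e v → proj₁ (up t e v) ≡ proj₁ v ∸ e
  layer-up zero v = refl
  layer-up (suc e) v =
    trans (layer-up e (parentOf t v))
          (trans (cong (_∸ e) (layer-parentOf v)) (∸-+-assoc (proj₁ v) 1 e))

  up-suc : ∀ e v → up t (suc e) v ≡ parentOf t (up t e v)
  up-suc zero v = refl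
  up-suc (suc e) v = up-suc e (parentOf t v)

  layer0-vertex : ∀ v → IsVertex t v → proj₁ v ≡ 0 → v ≡ (0 , 0)
  layer0-vertex (zero , zero) _ refl = refl
  layer0-vertex (zero , suc j) (s≤s ()) refl

  root-isDesc : ∀ x → IsVertex t x → IsDesc t (0 , 0) x
  root-isDesc x x-vtx =
    z≤n , layer0-vertex (up t (proj₁ x) x) (up-isVertex (proj₁ x) x x-vtx)
                        (trans (layer-up (proj₁ x) x) (n∸n≡0 (proj₁ x)))

  parentOf⇒∈childIndices : ∀ {k p} c → IsVertex t c → proj₁ c ≡ suc k →
                           parentOf t c ≡ (k , p) → proj₂ c ∈ childIndices k p
  parentOf⇒∈childIndices {k} (.(suc k) , j) j< refl parent≡ with nth (layer t (suc k)) j in nth≡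
  ... | just I  = ∈-positions (parentIs? _) (layer t (suc k)) j nth≡ (cong proj₂ parent≡)
  ... | nothing = contradiction (nth≡nothing⇒length≤ (layer t (suc k)) j nth≡) (<⇒≱ j<)

  isDesc-child : ∀ {k p} x → IsVertex t x → IsDesc t (k , p) x → x ≢ (k , p) →
                 ∃[ j ] (j ∈ childIndices k p × IsDesc t (suc k , j) x)
  isDesc-child {k} {p} x x-vtx (k≤x , up≡) x≢ with proj₁ x ∸ k in gap
  ... | zero  = contradiction up≡ x≢
  ... | suc d =
    proj₂ c , parentOf⇒∈childIndices c (up-isVertex d x x-vtx) c-layer c-parent , k<x , c-up
    where
      c = up t d x
      d≡ : d ≡ proj₁ x ∸ suc k
      d≡ = trans (cong pred (sym gap)) (pred[m∸n]≡m∸[1+n] (proj₁ x) k)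
      k<x : k < proj₁ x
      k<x = m∸n≢0⇒n<m (λ gap≡0 → 1+n≢0 (trans (sym gap) gap≡0))
      c-layer : proj₁ c ≡ suc k
      c-layer = trans (layer-up d x) (trans (cong (proj₁ x ∸_) d≡) (m∸[m∸n]≡n k<x))
      c-parent : parentOf t c ≡ (k , p)
      c-parent = trans (sym (up-suc d x)) up≡
      c-up : up t (proj₁ x ∸ suc k) x ≡ (suc k , proj₂ c)
      c-up = trans (cong (λ e → up t e x) (sym d≡)) (cong (_, proj₂ c) c-layer)

  #desc-≤-children : ∀ {S} k p → All (IsVertex t) S →
    #desc t S (k , p) ≤
    count (_≟ᵥ (k , p)) S + sum (map (λ j → #desc t S (suc k , j)) (childIndices k p))
  #desc-≤-children k p vertices =
    count-union-bound (isDesc? t (k , p)) (_≟ᵥ (k , p)) (λ j → isDesc? t (suc k , j))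
                      (childIndices k p) (All.map covers vertices)
    where
      covers : ∀ {x} → IsVertex t x → IsDesc t (k , p) x →
               x ≡ (k , p) ⊎ ∃[ j ] (j ∈ childIndices k p × IsDesc t (suc k , j) x)
      covers {x} x-vtx x-desc with x ≟ᵥ (k , p)
      ... | yes x≡ = inj₁ x≡
      ... | no x≢  = inj₂ (isDesc-child x x-vtx x-desc x≢)

  heavy-child : ∀ {n S k p} → 8 ≤ n → Unique S → All (IsVertex t) S →
                n < 4 * #desc t S (k , p) →
                ∃[ j ] (j ∈ childIndices k p × n ≤ 8 * 3 ^ (t + 1) * #desc t S (suc k , j))
  heavy-child {n} {S} {k} {p} 8≤n unique vertices heavy
    with any? (λ j → n ≤? 8 * 3 ^ (t + 1) * #desc t S (suc k , j)) (childIndices k p)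
  ... | yes some-heavy = find some-heavy
  ... | no ¬some-heavy = contradiction heavy (≤⇒≯ (d≤1+s∧8s≤n⇒4d≤n 8≤n parent≤ 8Σ≤n))
    where
      open ≤-Reasoning
      B = 3 ^ (t + 1)
      C = childIndices k p
      d : ℕ → ℕ
      d j = #desc t S (suc k , j)
      parent≤ : #desc t S (k , p) ≤ 1 + sum (map d C)
      parent≤ = ≤-trans (#desc-≤-children k p vertices)
                        (+-monoˡ-≤ _ (count-≡-≤1 _≟ᵥ_ (k , p) unique))
      children-light : All (λ j → 8 * B * d j ≤ n) C
      children-light = All.map (<⇒≤ ∘′ ≰⇒>) (All.¬Any⇒All¬ C ¬some-heavy)
      8Σ≤n : 8 * sum (map d C) ≤ n
      8Σ≤n = *-cancelˡ-≤ B {{m^n≢0 3 (t + 1)}} (begin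
        B * (8 * sum (map d C))          ≡⟨ trans (cong (_* sum (map d C)) (*-comm 8 B)) (*-assoc B 8 _) ⟨
        8 * B * sum (map d C)            ≡⟨ *-distribˡ-sum-map d (8 * B) C ⟩
        sum (map (λ j → 8 * B * d j) C)  ≤⟨ sum-map-≤ (λ j → 8 * B * d j) children-light ⟩
        length C * n                     ≤⟨ *-monoˡ-≤ n (length-childIndices k p) ⟩
        B * n                            ∎)

  module _ (n : ℕ) (S : List Vtx) where

    HeavyLayer : ℕ → Set
    HeavyLayer i = ∃[ j ] (j < length (layer t i) × n < 4 * #desc t S (i , j))

    heavyLayer? : Decidable HeavyLayer
    heavyLayer? i = anyUpTo? (λ j → n <? 4 * #desc t S (i , j)) (length (layer t i))

    ¬HeavyLayer⇒light : ∀ {i} → ¬ HeavyLayer i →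
                        ∀ v → IsVertex t v → proj₁ v ≡ i → 4 * #desc t S v ≤ n
    ¬HeavyLayer⇒light ¬heavy (i , j) j< refl = ≮⇒≥ (λ heavy → ¬heavy (j , j< , heavy))

    root-heavy : 0 < n → All (IsVertex t) S → length S ≡ n → HeavyLayer 0
    root-heavy 0<n vertices |S|≡n =
      0 , z<s , subst (λ d → n < 4 * d) (sym #desc-root) n<4n
      where
        n<4n : n < 4 * n
        n<4n = m<m+n n (≤-trans 0<n (m≤m+n n (2 * n)))
        #desc-root : #desc t S (0 , 0) ≡ n
        #desc-root =
          trans (cong length (filter-all (isDesc? t (0 , 0)) (All.map (root-isDesc _) vertices))) |S|≡n

    ¬HeavyLayer-deep : ¬ HeavyLayer (deepLayer S)
    ¬HeavyLayer-deep (j , _ , heavy) = n≮0 (subst (λ d → n < 4 * d) #desc-deep heavy)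
      where
        #desc-deep : #desc t S (deepLayer S , j) ≡ 0
        #desc-deep = count-none (isDesc? t (deepLayer S , j)) {S}
          (All.tabulate (λ x∈S x-desc → <⇒≱ (∈⇒≤sum-map (suc ∘′ proj₁) x∈S) (proj₁ x-desc)))

-- The argument works for t = 0 as well, so the hypothesis 1 ≤ t is unused.
lemma4p8 : (t : ℕ) → 1 ≤ t → (n : ℕ) → 8 ≤ n →
    (S : List Vtx) → Unique S → All (IsVertex t) S → length S ≡ n →
    ∃[ u ] (IsVertex t u
      × n ≤ 8 * 3 ^ (t + 1) * #desc t S u
      × 4 * #desc t S u ≤ n
      × ((v : Vtx) → IsVertex t v → proj₁ v ≡ proj₁ u → 4 * #desc t S v ≤ n))
lemma4p8 t _ n 8≤n S unique vertices |S|≡n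
  with switch-point (heavyLayer? t n S) (root-heavy t n S (≤-trans z<s 8≤n) vertices |S|≡n)
                    (deepLayer S) (¬HeavyLayer-deep t n S)
... | k , (p , _ , p-heavy) , ¬heavy-next
  with heavy-child t 8≤n unique vertices p-heavy
... | j , j∈children , n≤weight =
  let light = ¬HeavyLayer⇒light t n S ¬heavy-next
      j-vtx = positions-< (parentIs? t p) (layer t (suc k)) j∈children
  in (suc k , j) , j-vtx , n≤weight , light (suc k , j) j-vtx refl , light
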